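{- Let $R$ be a commutative ring and let $G$ be a cycle graph with an edge labeling $\alpha$ over $R$. Then $(G,\alpha)$ satisfies the Universal Difference Property.
   Context: Graphs are finite. An edge labeling of a graph $G=(V,E)$ over a commutative ring $R$ is a function $\alpha:E\to\mathcal{I}(R)$ assigning to each edge an ideal of $R$. A (generalized) spline on $(G,\alpha)$ is a function $\rho:V\to R$ such that for each edge $ab$, $\rho(a)-\rho(b)\in\alpha(ab)$. For vertices $u,w$, $\mathcal{P}_{(u,w)}$ denotes the set of all paths in $G$ from $u$ to $w$, and for a path $P$ with edges $e_1,\dots,e_k$, $\alpha(P)=\alpha(e_1)+\cdots+\alpha(e_k)$. $(G,\alpha)$ satisfies the Universal Difference Property (UDP) if for every pair of vertices $u,w$ connected by a path in $G$ and every $x\in\bigcap_{P\in\mathcal{P}_{(u,w)}}\alpha(P)$ there exists a spline $\rho$ on $(G,\alpha)$ with $\rho(u)-\rho(w)=x$. -}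

module Defs where

open import Level using (Level; _⊔_; Lift)
open import Algebra.Bundles using (CommutativeRing)
open import Data.Nat using (ℕ; suc)
open import Data.Nat.DivMod using (_mod_)
open import Data.Fin using (Fin; toℕ)
open import Data.Product using (Σ; ∃; _×_; _,_; proj₁; proj₂)
open import Data.Sum using (_⊎_)
open import Data.List using (List; []; _∷_; map)
open import Data.List.Relation.Unary.Unique.Propositional using (Unique)
open import Relation.Binary.PropositionalEquality using (_≡_)
open import Relation.Unary using (Pred; _∈_)

module RingDefs {c ℓ : Level} (R : CommutativeRing c ℓ) where
  open CommutativeRing R

  record Ideal : Set (Level.suc (c ⊔ ℓ)) where
    field
      mem    : Pred Carrier (c ⊔ ℓ)
      resp   : ∀ {x y} → x ≈ y → mem x → mem y
      has-0  : mem 0#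
      +-closed : ∀ {x y} → mem x → mem y → mem (x + y)
      -‿closed : ∀ {x} → mem x → mem (- x)
      *-closed : ∀ r {x} → mem x → mem (r * x)
  open Ideal public

  _⊕_ : Pred Carrier (c ⊔ ℓ) → Pred Carrier (c ⊔ ℓ) → Pred Carrier (c ⊔ ℓ)
  (I ⊕ J) x = Σ Carrier λ a → Σ Carrier λ b → I a × J b × (x ≈ a + b)

  zeroIdeal : Pred Carrier (c ⊔ ℓ)
  zeroIdeal x = Lift (c ⊔ ℓ) (x ≈ 0#)

  sumIdeals : List Ideal → Pred Carrier (c ⊔ ℓ)
  sumIdeals []       = zeroIdeal
  sumIdeals (I ∷ Is) = mem I ⊕ sumIdeals Is

record Graph : Set where
  field
    V    : ℕ
    E    : ℕ
    ends : Fin E → Fin V × Fin V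
open Graph public

module GraphDefs (G : Graph) where
  Joins : Fin (E G) → Fin (V G) → Fin (V G) → Set
  Joins e u v = (ends G e ≡ (u , v)) ⊎ (ends G e ≡ (v , u))

  data Walk : Fin (V G) → Fin (V G) → Set where
    []   : ∀ {u} → Walk u u
    step : ∀ {u v w} (e : Fin (E G)) → Joins e u v → Walk v w → Walk u w

  vertices : ∀ {u w} → Walk u w → List (Fin (V G))
  vertices {u} []              = u ∷ []
  vertices {u} (step _ _ rest) = u ∷ vertices rest

  edges : ∀ {u w} → Walk u w → List (Fin (E G))
  edges []              = []
  edges (step e _ rest) = e ∷ edges rest

  Path : Fin (V G) → Fin (V G) → Set
  Path u w = Σ (Walk u w) λ p → Unique (vertices p)

module SplineDefs {c ℓ : Level} (R : CommutativeRing c ℓ) (G : Graph) where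
  open CommutativeRing R
  open RingDefs R
  open GraphDefs G

  EdgeLabeling : Set (Level.suc (c ⊔ ℓ))
  EdgeLabeling = Fin (E G) → Ideal

  pathIdeal : EdgeLabeling → ∀ {u w} → Path u w → Pred Carrier (c ⊔ ℓ)
  pathIdeal α P = sumIdeals (map α (edges (proj₁ P)))

  IsSpline : EdgeLabeling → (Fin (V G) → Carrier) → Set (c ⊔ ℓ)
  IsSpline α ρ = ∀ e → mem (α e) (ρ (proj₁ (ends G e)) - ρ (proj₂ (ends G e)))

  UDP : EdgeLabeling → Set (c ⊔ ℓ)
  UDP α = ∀ u w → Path u w →
          ∀ x → (∀ (P : Path u w) → pathIdeal α P x) →
          Σ (Fin (V G) → Carrier) λ ρ → IsSpline α ρ × (ρ u - ρ w ≈ x)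

-- The cycle graph C_n on n = k + 3 vertices: edge i joins i and i+1 (mod n)

cycleGraph : ℕ → Graph
cycleGraph k = record
  { V    = suc (suc (suc k))
  ; E    = suc (suc (suc k))
  ; ends = λ i → i , (suc (toℕ i) mod suc (suc (suc k)))
  }

-- For distinct vertices u, w of a cycle, the two arcs from u to w are paths that together
-- use every edge and share only u and w. An element x of the sum of the labels along a path
-- splits into one summand per edge, and assigning these summands backwards from w gives a
-- spline on the path with value x at u and 0 at w. The splines on the two arcs agree at u
-- and w, so they glue to a spline on the whole cycle. For u = w the trivial path forces x = 0.

module Submission where

open import Defs
open import Level using (Level; _⊔_; lift; lower)
open import Algebra.Bundles using (CommutativeRing)
open import Data.Nat using (ℕ)

open import Data.Fin.Base using (Fin; toℕ)
open import Data.Fin.Properties using (toℕ-fromℕ<; toℕ-injective; toℕ<n; _≟_)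
open import Data.Product using (Σ; ∃-syntax; _×_; _,_; proj₁; proj₂)
open import Data.Sum using (_⊎_; inj₁; inj₂)
open import Data.List.Base using (List; []; _∷_; map)
open import Data.List.Relation.Unary.Any using (here; there)
import Data.List.Relation.Unary.All as All
open import Data.List.Relation.Unary.AllPairs using ([]; _∷_)
open import Data.List.Relation.Unary.Unique.Propositional using (Unique)
open import Data.List.Membership.Propositional using (_∈_)
open import Data.Vec.Functional using (updateAt)
open import Data.Vec.Functional.Properties using (updateAt-updates; updateAt-minimal)
open import Relation.Nullary using (yes; no; contradiction)
open import Relation.Binary.PropositionalEquality
  using (_≡_; _≢_; refl; sym; trans; cong; subst; module ≡-Reasoning)

module WalkProperties (G : Graph) where
  open GraphDefs G

  head∈vertices : ∀ {a b} (W : Walk a b) → a ∈ vertices W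
  head∈vertices []           = here refl
  head∈vertices (step _ _ _) = here refl

  last∈vertices : ∀ {a b} (W : Walk a b) → b ∈ vertices W
  last∈vertices []           = here refl
  last∈vertices (step _ _ W) = there (last∈vertices W)

  ends∈vertices : ∀ {a b} (W : Walk a b) {e} → e ∈ edges W →
                  proj₁ (ends G e) ∈ vertices W × proj₂ (ends G e) ∈ vertices W
  ends∈vertices (step e (inj₁ refl) W) (here refl) = here refl , there (head∈vertices W)
  ends∈vertices (step e (inj₂ refl) W) (here refl) = there (head∈vertices W) , here refl
  ends∈vertices (step _ _ W) (there e∈W) with ends∈vertices W e∈W
  ... | source∈W , target∈W = there source∈W , there target∈W

  record CoveringPaths (u w : Fin (V G)) : Set where
    field
      left right   : Path u w
      covers       : ∀ e → e ∈ edges (proj₁ left) ⊎ e ∈ edges (proj₁ right)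
      meet-at-ends : ∀ {v} → v ∈ vertices (proj₁ left) → v ∈ vertices (proj₁ right) →
                     v ≡ u ⊎ v ≡ w

module Splines {c ℓ : Level} (R : CommutativeRing c ℓ) (G : Graph) where
  open CommutativeRing R renaming (refl to ≈-refl; sym to ≈-sym; trans to ≈-trans)
  open RingDefs R
  open GraphDefs G
  open SplineDefs R G
  open WalkProperties G
  open import Algebra.Properties.Group +-group using (ε⁻¹≈ε; //-rightDividesʳ)
  open import Algebra.Properties.AbelianGroup +-abelianGroup using (⁻¹-anti-homo‿-)
  open import Data.List.Membership.DecPropositional (_≟_ {V G}) using (_∈?_)
  open import Relation.Binary.Reasoning.Setoid setoid

  edgeDifference : (Fin (V G) → Carrier) → Fin (E G) → Carrier
  edgeDifference ρ e = ρ (proj₁ (ends G e)) - ρ (proj₂ (ends G e))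

  SplineOn : EdgeLabeling → List (Fin (E G)) → (Fin (V G) → Carrier) → Set (c ⊔ ℓ)
  SplineOn α es ρ = ∀ {e} → e ∈ es → mem (α e) (edgeDifference ρ e)

  mem-swap : ∀ (I : Ideal) {x y} → mem I (x - y) → mem I (y - x)
  mem-swap I x-y∈I = resp I (⁻¹-anti-homo‿- _ _) (-‿closed I x-y∈I)

  Joins⇒mem-edgeDifference : ∀ (I : Ideal) {e a b} (ρ : Fin (V G) → Carrier) → Joins e a b →
                             mem I (ρ a - ρ b) → mem I (edgeDifference ρ e)
  Joins⇒mem-edgeDifference I ρ (inj₁ refl) ρa-ρb∈I = ρa-ρb∈I
  Joins⇒mem-edgeDifference I ρ (inj₂ refl) ρa-ρb∈I = mem-swap I ρa-ρb∈I

  SplineOn-cong : ∀ (α : EdgeLabeling) {a b} (W : Walk a b) {ρ σ : Fin (V G) → Carrier} →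
                  (∀ {v} → v ∈ vertices W → ρ v ≈ σ v) →
                  SplineOn α (edges W) σ → SplineOn α (edges W) ρ
  SplineOn-cong α W ρ≈σ σ-spline e∈W with ends∈vertices W e∈W
  ... | source∈W , target∈W =
    resp (α _) (≈-sym (+-cong (ρ≈σ source∈W) (-‿cong (ρ≈σ target∈W)))) (σ-spline e∈W)

  path-spline : ∀ (α : EdgeLabeling) {a b} (W : Walk a b) → Unique (vertices W) →
                ∀ {y} → sumIdeals (map α (edges W)) y →
                Σ (Fin (V G) → Carrier) λ f → f a ≈ y × f b ≈ 0# × SplineOn α (edges W) f
  path-spline α [] _ (lift y≈0) = (λ _ → 0#) , ≈-sym y≈0 , ≈-refl , λ ()
  path-spline α {a} {b} (step {v = v} e J W) (a∉W ∷ unique-W) {y}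
              (z , y′ , z∈αe , y′∈αW , y≈z+y′)
    with path-spline α W unique-W y′∈αW
  ... | f , fv≈y′ , fb≈0 , f-spline = g , reflexive ga≡y , gb≈0 , g-spline
    where
      g : Fin (V G) → Carrier
      g = updateAt f a (λ _ → y)

      ga≡y : g a ≡ y
      ga≡y = updateAt-updates a f

      g≡f-on-W : ∀ {x} → x ∈ vertices W → g x ≡ f x
      g≡f-on-W x∈W = updateAt-minimal _ a f (λ x≡a → All.lookup a∉W x∈W (sym x≡a))

      gv≡fv : g v ≡ f v
      gv≡fv = g≡f-on-W (head∈vertices W)

      gb≈0 : g b ≈ 0#
      gb≈0 = ≈-trans (reflexive (g≡f-on-W (last∈vertices W))) fb≈0

      z≈ga-gv : z ≈ g a - g v
      z≈ga-gv = begin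
        z             ≈⟨ //-rightDividesʳ y′ z ⟨
        z + y′ - y′   ≈⟨ +-cong (≈-sym y≈z+y′) (-‿cong (≈-sym fv≈y′)) ⟩
        y - f v       ≈⟨ +-cong (reflexive ga≡y) (-‿cong (reflexive gv≡fv)) ⟨
        g a - g v     ∎

      g-spline : SplineOn α (edges (step e J W)) g
      g-spline (here refl) = Joins⇒mem-edgeDifference (α e) g J (resp (α e) z≈ga-gv z∈αe)
      g-spline (there e∈W) = SplineOn-cong α W (λ x∈W → reflexive (g≡f-on-W x∈W)) f-spline e∈W

  covering-spline : ∀ (α : EdgeLabeling) {u w} → CoveringPaths u w →
                    ∀ x → (∀ (P : Path u w) → pathIdeal α P x) →
                    Σ (Fin (V G) → Carrier) λ ρ → IsSpline α ρ × ρ u - ρ w ≈ x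
  covering-spline α {u} {w} record { left = A , unique-A ; right = B , unique-B
                                   ; covers = covers ; meet-at-ends = meet-at-ends } x x∈
    with path-spline α A unique-A (x∈ (A , unique-A))
       | path-spline α B unique-B (x∈ (B , unique-B))
  ... | f , fu≈x , fw≈0 , f-spline | g , gu≈x , gw≈0 , g-spline = ρ , ρ-spline , ρu-ρw≈x
    where
      ρ : Fin (V G) → Carrier
      ρ v with v ∈? vertices A
      ... | yes _ = f v
      ... | no  _ = g v

      f≈g-at-ends : ∀ {v} → v ≡ u ⊎ v ≡ w → f v ≈ g v
      f≈g-at-ends (inj₁ refl) = ≈-trans fu≈x (≈-sym gu≈x)
      f≈g-at-ends (inj₂ refl) = ≈-trans fw≈0 (≈-sym gw≈0)

      ρ≈f-on-A : ∀ {v} → v ∈ vertices A → ρ v ≈ f v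
      ρ≈f-on-A {v} v∈A with v ∈? vertices A
      ... | yes _   = ≈-refl
      ... | no  v∉A = contradiction v∈A v∉A

      ρ≈g-on-B : ∀ {v} → v ∈ vertices B → ρ v ≈ g v
      ρ≈g-on-B {v} v∈B with v ∈? vertices A
      ... | yes v∈A = f≈g-at-ends (meet-at-ends v∈A v∈B)
      ... | no  _   = ≈-refl

      ρ-spline : IsSpline α ρ
      ρ-spline e with covers e
      ... | inj₁ e∈A = SplineOn-cong α A ρ≈f-on-A f-spline e∈A
      ... | inj₂ e∈B = SplineOn-cong α B ρ≈g-on-B g-spline e∈B

      ρu-ρw≈x : ρ u - ρ w ≈ x
      ρu-ρw≈x = begin
        ρ u - ρ w  ≈⟨ +-cong (≈-trans (ρ≈f-on-A (head∈vertices A)) fu≈x)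
                             (-‿cong (≈-trans (ρ≈f-on-A (last∈vertices A)) fw≈0)) ⟩
        x - 0#     ≈⟨ +-congˡ ε⁻¹≈ε ⟩
        x + 0#     ≈⟨ +-identityʳ x ⟩
        x          ∎

  trivial-difference : ∀ (α : EdgeLabeling) {u} x → (∀ (P : Path u u) → pathIdeal α P x) →
                       Σ (Fin (V G) → Carrier) λ ρ → IsSpline α ρ × ρ u - ρ u ≈ x
  trivial-difference α x x∈ = (λ _ → 0#) , zero-spline , ≈-trans (-‿inverseʳ 0#) (≈-sym x≈0)
    where
      zero-spline : IsSpline α (λ _ → 0#)
      zero-spline e = resp (α e) (≈-sym (-‿inverseʳ 0#)) (has-0 (α e))

      x≈0 : x ≈ 0#
      x≈0 = lower (x∈ ([] , All.[] ∷ []))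

  UDP-from-coverings : ∀ (α : EdgeLabeling) → (∀ {u w} → u ≢ w → CoveringPaths u w) → UDP α
  UDP-from-coverings α covering u w _ x x∈ with u ≟ w
  ... | yes refl = trivial-difference α x x∈
  ... | no  u≢w  = covering-spline α (covering u≢w) x x∈

open import Data.Nat.Base using (zero; suc; _+_; _∸_; _≤_; _<_; NonZero; z≤n; s≤s)
open import Data.Nat.Properties
  using (_<?_; +-comm; +-assoc; +-suc; +-identityʳ; ≤-refl; <-trans; ≤-<-trans; <⇒≤;
         ≤-antisym; ≮⇒≥; n<1+n; 1+n≰n; n≤0⇒n≡0; +-cancelʳ-≤; m≤n⇒m≤1+n; m<1+n⇒m<n∨m≡n;
         n≢0⇒n>0; m+[n∸m]≡n; m∸n+n≡m; ∸-monoˡ-<; ∸-monoʳ-<; m≤o∸n⇒m+n≤o)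
open import Data.Nat.DivMod
  using (_%_; _mod_; %-distribˡ-+; m%n%n≡m%n; [m+n]%n≡m%n; m%n<n; m<n⇒m%n≡m)

[m+n%o]%o≡[m+n]%o : ∀ m n o .{{_ : NonZero o}} → (m + n % o) % o ≡ (m + n) % o
[m+n%o]%o≡[m+n]%o m n o = begin
  (m + n % o) % o           ≡⟨ %-distribˡ-+ m (n % o) o ⟩
  (m % o + n % o % o) % o   ≡⟨ cong (λ r → (m % o + r) % o) (m%n%n≡m%n n o) ⟩
  (m % o + n % o) % o       ≡⟨ %-distribˡ-+ m n o ⟨
  (m + n) % o               ∎
  where open ≡-Reasoning

[m%o+n]%o≡[m+n]%o : ∀ m n o .{{_ : NonZero o}} → (m % o + n) % o ≡ (m + n) % o
[m%o+n]%o≡[m+n]%o m n o = begin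
  (m % o + n) % o   ≡⟨ cong (_% o) (+-comm (m % o) n) ⟩
  (n + m % o) % o   ≡⟨ [m+n%o]%o≡[m+n]%o n m o ⟩
  (n + m) % o       ≡⟨ cong (_% o) (+-comm n m) ⟩
  (m + n) % o       ∎
  where open ≡-Reasoning

module Cycle (k : ℕ) where
  open GraphDefs (cycleGraph k)
  open WalkProperties (cycleGraph k)
  open ≡-Reasoning

  N : ℕ
  N = suc (suc (suc k))

  -- next v is definitionally the second endpoint of the edge v.
  next : Fin N → Fin N
  next v = suc (toℕ v) mod N

  next^ : ℕ → Fin N → Fin N
  next^ zero    v = v
  next^ (suc i) v = next^ i (next v)

  toℕ-next : ∀ v → toℕ (next v) ≡ suc (toℕ v) % N
  toℕ-next v = toℕ-fromℕ< (m%n<n (suc (toℕ v)) N)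

  next^-+ : ∀ i j v → next^ i (next^ j v) ≡ next^ (i + j) v
  next^-+ i zero    v = cong (λ n → next^ n v) (sym (+-identityʳ i))
  next^-+ i (suc j) v = trans (next^-+ i j (next v)) (cong (λ n → next^ n v) (sym (+-suc i j)))

  toℕ-next^ : ∀ i v → toℕ (next^ i v) ≡ (i + toℕ v) % N
  toℕ-next^ zero    v = sym (m<n⇒m%n≡m (toℕ<n v))
  toℕ-next^ (suc i) v = begin
    toℕ (next^ i (next v))        ≡⟨ toℕ-next^ i (next v) ⟩
    (i + toℕ (next v)) % N        ≡⟨ cong (λ n → (i + n) % N) (toℕ-next v) ⟩
    (i + suc (toℕ v) % N) % N     ≡⟨ [m+n%o]%o≡[m+n]%o i (suc (toℕ v)) N ⟩
    (i + suc (toℕ v)) % N         ≡⟨ cong (_% N) (+-suc i (toℕ v)) ⟩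
    (suc i + toℕ v) % N           ∎

  next^-N : ∀ v → next^ N v ≡ v
  next^-N v = toℕ-injective (begin
    toℕ (next^ N v)    ≡⟨ toℕ-next^ N v ⟩
    (N + toℕ v) % N    ≡⟨ cong (_% N) (+-comm N (toℕ v)) ⟩
    (toℕ v + N) % N    ≡⟨ [m+n]%n≡m%n (toℕ v) N ⟩
    toℕ v % N          ≡⟨ m<n⇒m%n≡m (toℕ<n v) ⟩
    toℕ v              ∎)

  offset : Fin N → Fin N → ℕ
  offset w v = (toℕ v + (N ∸ toℕ w)) % N

  offset<N : ∀ w v → offset w v < N
  offset<N w v = m%n<n (toℕ v + (N ∸ toℕ w)) N

  next^-offset : ∀ w v → next^ (offset w v) w ≡ v
  next^-offset w v = toℕ-injective (begin
    toℕ (next^ (offset w v) w)     ≡⟨ toℕ-next^ (offset w v) w ⟩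
    ((x + (N ∸ m)) % N + m) % N    ≡⟨ [m%o+n]%o≡[m+n]%o (x + (N ∸ m)) m N ⟩
    (x + (N ∸ m) + m) % N          ≡⟨ cong (_% N) (+-assoc x (N ∸ m) m) ⟩
    (x + ((N ∸ m) + m)) % N        ≡⟨ cong (λ n → (x + n) % N) (m∸n+n≡m (<⇒≤ (toℕ<n w))) ⟩
    (x + N) % N                    ≡⟨ [m+n]%n≡m%n x N ⟩
    x % N                          ≡⟨ m<n⇒m%n≡m (toℕ<n v) ⟩
    x                              ∎)
    where
      x m : ℕ
      x = toℕ v
      m = toℕ w

  offset-next^ : ∀ w {i} → i < N → offset w (next^ i w) ≡ i
  offset-next^ w {i} i<N = begin
    (toℕ (next^ i w) + (N ∸ m)) % N   ≡⟨ cong (λ n → (n + (N ∸ m)) % N) (toℕ-next^ i w) ⟩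
    ((i + m) % N + (N ∸ m)) % N       ≡⟨ [m%o+n]%o≡[m+n]%o (i + m) (N ∸ m) N ⟩
    (i + m + (N ∸ m)) % N             ≡⟨ cong (_% N) (+-assoc i m (N ∸ m)) ⟩
    (i + (m + (N ∸ m))) % N           ≡⟨ cong (λ n → (i + n) % N) (m+[n∸m]≡n (<⇒≤ (toℕ<n w))) ⟩
    (i + N) % N                       ≡⟨ [m+n]%n≡m%n i N ⟩
    i % N                             ≡⟨ m<n⇒m%n≡m i<N ⟩
    i                                 ∎
    where
      m : ℕ
      m = toℕ w

  next^-injective : ∀ w {i j} → i < N → j < N → next^ i w ≡ next^ j w → i ≡ j
  next^-injective w {i} {j} i<N j<N eq = begin
    i                    ≡⟨ offset-next^ w i<N ⟨
    offset w (next^ i w) ≡⟨ cong (offset w) eq ⟩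
    offset w (next^ j w) ≡⟨ offset-next^ w j<N ⟩
    j                    ∎

  forwardArc : ∀ v d {x} → next^ d v ≡ x → Walk v x
  forwardArc v zero    refl = []
  forwardArc v (suc d) end  = step v (inj₁ refl) (forwardArc (next v) d end)

  ∈-vertices-forwardArc : ∀ v d {x} (end : next^ d v ≡ x) {y} → y ∈ vertices (forwardArc v d end) →
                          ∃[ i ] i ≤ d × y ≡ next^ i v
  ∈-vertices-forwardArc v zero    refl (here refl) = 0 , z≤n , refl
  ∈-vertices-forwardArc v (suc d) end  (here refl) = 0 , z≤n , refl
  ∈-vertices-forwardArc v (suc d) end  (there y∈) with ∈-vertices-forwardArc (next v) d end y∈
  ... | i , i≤d , y≡ = suc i , s≤s i≤d , y≡

  next^-∈-edges-forwardArc : ∀ v d {x} (end : next^ d v ≡ x) {i} → i < d →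
                             next^ i v ∈ edges (forwardArc v d end)
  next^-∈-edges-forwardArc v (suc d) end {zero}  _         = here refl
  next^-∈-edges-forwardArc v (suc d) end {suc i} (s≤s i<d) =
    there (next^-∈-edges-forwardArc (next v) d end i<d)

  forwardArc-unique : ∀ v d {x} (end : next^ d v ≡ x) → d < N → Unique (vertices (forwardArc v d end))
  forwardArc-unique v zero    refl _     = All.[] ∷ []
  forwardArc-unique v (suc d) end  1+d<N =
    All.tabulate v∉rest ∷ forwardArc-unique (next v) d end (<-trans (n<1+n d) 1+d<N)
    where
      v∉rest : ∀ {y} → y ∈ vertices (forwardArc (next v) d end) → v ≢ y
      v∉rest y∈ v≡y with ∈-vertices-forwardArc (next v) d end y∈
      ... | i , i≤d , y≡
        with next^-injective v (≤-<-trans z≤n 1+d<N) (≤-<-trans (s≤s i≤d) 1+d<N) (trans v≡y y≡)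
      ... | ()

  backwardArc : ∀ v d → Walk (next^ d v) v
  backwardArc v zero    = []
  backwardArc v (suc d) =
    step (next^ d v) (inj₂ (cong (next^ d v ,_) (next^-+ 1 d v))) (backwardArc v d)

  ∈-vertices-backwardArc : ∀ v d {y} → y ∈ vertices (backwardArc v d) →
                           ∃[ i ] i ≤ d × y ≡ next^ i v
  ∈-vertices-backwardArc v zero    (here refl) = 0 , z≤n , refl
  ∈-vertices-backwardArc v (suc d) (here refl) = suc d , ≤-refl , refl
  ∈-vertices-backwardArc v (suc d) (there y∈) with ∈-vertices-backwardArc v d y∈
  ... | i , i≤d , y≡ = i , m≤n⇒m≤1+n i≤d , y≡

  next^-∈-edges-backwardArc : ∀ v d {i} → i < d → next^ i v ∈ edges (backwardArc v d)
  next^-∈-edges-backwardArc v (suc d) i<1+d with m<1+n⇒m<n∨m≡n i<1+d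
  ... | inj₁ i<d  = there (next^-∈-edges-backwardArc v d i<d)
  ... | inj₂ refl = here refl

  backwardArc-unique : ∀ v d → d < N → Unique (vertices (backwardArc v d))
  backwardArc-unique v zero    _     = All.[] ∷ []
  backwardArc-unique v (suc d) 1+d<N =
    All.tabulate top∉rest ∷ backwardArc-unique v d (<-trans (n<1+n d) 1+d<N)
    where
      top∉rest : ∀ {y} → y ∈ vertices (backwardArc v d) → next^ (suc d) v ≢ y
      top∉rest y∈ top≡y with ∈-vertices-backwardArc v d y∈
      ... | i , i≤d , y≡
        with next^-injective v 1+d<N (≤-<-trans (m≤n⇒m≤1+n i≤d) 1+d<N) (trans top≡y y≡)
      ... | refl = 1+n≰n i≤d

  module _ (w : Fin N) {t} (0<t : 0 < t) (t<N : t < N) where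
    forward-closes : next^ (N ∸ t) (next^ t w) ≡ w
    forward-closes = begin
      next^ (N ∸ t) (next^ t w)  ≡⟨ next^-+ (N ∸ t) t w ⟩
      next^ (N ∸ t + t) w        ≡⟨ cong (λ n → next^ n w) (m∸n+n≡m (<⇒≤ t<N)) ⟩
      next^ N w                  ≡⟨ next^-N w ⟩
      w                          ∎

    forward : Walk (next^ t w) w
    forward = forwardArc (next^ t w) (N ∸ t) forward-closes

    backward : Walk (next^ t w) w
    backward = backwardArc w t

    arcs-cover : ∀ e → e ∈ edges forward ⊎ e ∈ edges backward
    arcs-cover e with offset w e <? t
    ... | yes s<t =
      inj₂ (subst (_∈ edges backward) (next^-offset w e) (next^-∈-edges-backwardArc w t s<t))
    ... | no  s≮t =
      inj₁ (subst (_∈ edges forward) e≡ (next^-∈-edges-forwardArc _ (N ∸ t) forward-closes s∸t<))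
      where
        s : ℕ
        s = offset w e
        s∸t< : s ∸ t < N ∸ t
        s∸t< = ∸-monoˡ-< (offset<N w e) (≮⇒≥ s≮t)
        e≡ : next^ (s ∸ t) (next^ t w) ≡ e
        e≡ = begin
          next^ (s ∸ t) (next^ t w)  ≡⟨ next^-+ (s ∸ t) t w ⟩
          next^ (s ∸ t + t) w        ≡⟨ cong (λ n → next^ n w) (m∸n+n≡m (≮⇒≥ s≮t)) ⟩
          next^ s w                  ≡⟨ next^-offset w e ⟩
          e                          ∎

    arcs-meet-at-ends : ∀ {v} → v ∈ vertices forward → v ∈ vertices backward →
                        v ≡ next^ t w ⊎ v ≡ w
    arcs-meet-at-ends {v} v∈F v∈B
      with ∈-vertices-forwardArc (next^ t w) (N ∸ t) forward-closes v∈F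
         | ∈-vertices-backwardArc w t v∈B
    ... | i , i≤N∸t , v≡ | j , j≤t , v≡′ with i + t <? N
    ...   | no  i+t≮N = inj₂ (begin
            v                   ≡⟨ v≡ ⟩
            next^ i (next^ t w) ≡⟨ next^-+ i t w ⟩
            next^ (i + t) w     ≡⟨ cong (λ n → next^ n w) i+t≡N ⟩
            next^ N w           ≡⟨ next^-N w ⟩
            w                   ∎)
      where
        i+t≡N : i + t ≡ N
        i+t≡N = ≤-antisym (m≤o∸n⇒m+n≤o i (<⇒≤ t<N) i≤N∸t) (≮⇒≥ i+t≮N)
    ...   | yes i+t<N = inj₁ (trans v≡ (cong (λ n → next^ n (next^ t w)) i≡0))
      where
        i+t≡j : i + t ≡ j
        i+t≡j = next^-injective w i+t<N (≤-<-trans j≤t t<N)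
                  (trans (sym (next^-+ i t w)) (trans (sym v≡) v≡′))
        i≡0 : i ≡ 0
        i≡0 = n≤0⇒n≡0 (+-cancelʳ-≤ t i 0 (subst (_≤ t) (sym i+t≡j) j≤t))

    arcs-covering : CoveringPaths (next^ t w) w
    arcs-covering = record
      { left         = forward , forwardArc-unique _ (N ∸ t) forward-closes (∸-monoʳ-< 0<t (<⇒≤ t<N))
      ; right        = backward , backwardArc-unique w t t<N
      ; covers       = arcs-cover
      ; meet-at-ends = arcs-meet-at-ends
      }

  cycle-covering : ∀ {u w} → u ≢ w → CoveringPaths u w
  cycle-covering {u} {w} u≢w =
    subst (λ v → CoveringPaths v w) (next^-offset w u)
          (arcs-covering w (n≢0⇒n>0 offset≢0) (offset<N w u))
    where
      offset≢0 : offset w u ≢ 0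
      offset≢0 offset≡0 = u≢w (trans (sym (next^-offset w u)) (cong (λ n → next^ n w) offset≡0))

mainTheorem4 : ∀ {c ℓ : Level} (R : CommutativeRing c ℓ) (k : ℕ)
    (α : SplineDefs.EdgeLabeling R (cycleGraph k)) →
    SplineDefs.UDP R (cycleGraph k) α
mainTheorem4 R k α = Splines.UDP-from-coverings R (cycleGraph k) α (Cycle.cycle-covering k)
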